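{- Let $\delta=10\in\mathbb{F}_{17}$ and let $\alpha\in\mathbb{F}_{17^2}$ be a root of $x^2-\delta$. Let $H=\{1,4,16,13\}$ and $C_{17}^D=\{0\}\cup H\cup(\alpha+7)\{1,16\}\cup(\alpha+10)\{4,13\}$. Then the setwise stabilizer of $C_{17}^D$ in $\mathrm{Aut}(P(17^2))$ is $\langle\sigma\rangle\cong\mathbb{Z}_4$, where $\sigma(\gamma)=4\gamma^{17}$ for all $\gamma\in\mathbb{F}_{17^2}$. Moreover, the orbit of $C_{17}^D$ under $\mathrm{Aut}(P(17^2))$ has size $20808$.
   Context: The Paley graph $P(17^2)$ has vertex set $\mathbb{F}_{17^2}$, two distinct vertices adjacent iff their difference is a nonzero square. $\mathrm{Aut}(P(17^2))=\{\gamma\mapsto a\gamma^{v}+b : a \text{ a nonzero square of } \mathbb{F}_{17^2},\ b\in\mathbb{F}_{17^2},\ v\in\mathrm{Gal}(\mathbb{F}_{17^2})\}$, acting on subsets elementwise. Elements of $\mathbb{F}_{17}$ are written as integers mod $17$. -}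

module Defs where

open import Data.Nat as ℕ using (ℕ; zero; suc)
open import Data.Nat.DivMod using (_mod_)
open import Data.Fin using (Fin; toℕ)
open import Data.Product using (_×_; _,_; Σ; ∃; ∃-syntax)
open import Data.List using (List; []; _∷_)
open import Data.List.Membership.Propositional using (_∈_)
open import Relation.Binary.PropositionalEquality using (_≡_)
open import Relation.Nullary using (¬_)
open import Function.Bundles using (_⇔_)

F17 : Set
F17 = Fin 17

infixl 6 _+₁₇_ _-₁₇_
infixl 7 _*₁₇_

_+₁₇_ : F17 → F17 → F17
x +₁₇ y = (toℕ x ℕ.+ toℕ y) mod 17

_*₁₇_ : F17 → F17 → F17
x *₁₇ y = (toℕ x ℕ.* toℕ y) mod 17

-₁₇_ : F17 → F17
-₁₇ x = (17 ℕ.∸ toℕ x) mod 17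

_-₁₇_ : F17 → F17 → F17
x -₁₇ y = x +₁₇ (-₁₇ y)

[_]₁₇ : ℕ → F17
[ n ]₁₇ = n mod 17

-- δ = 10, a non-square in 𝔽₁₇
δ₁₇ : F17
δ₁₇ = [ 10 ]₁₇

-- The field 𝔽₁₇² = 𝔽₁₇[e]/(e² - 10); the pair (a , b) stands for a + b·e.

F : Set
F = F17 × F17

infixl 6 _+_
infixl 7 _*_

_+_ : F → F → F
(a , b) + (c , d) = (a +₁₇ c , b +₁₇ d)

_*_ : F → F → F
(a , b) * (c , d) = (a *₁₇ c +₁₇ δ₁₇ *₁₇ (b *₁₇ d) , a *₁₇ d +₁₇ b *₁₇ c)

ι : ℕ → F
ι n = ([ n ]₁₇ , [ 0 ]₁₇)

0F 1F δ : F
0F = ι 0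
1F = ι 1
δ = ι 10

_^_ : F → ℕ → F
x ^ zero  = 1F
x ^ suc n = x * (x ^ n)

-- Automorphisms of the Paley graph P(17²):
-- γ ↦ a γ^v + b, a a nonzero square, b ∈ 𝔽₁₇², v ∈ Gal(𝔽₁₇²) = {γ ↦ γ^(17^i) | i ∈ {0,1}}.

IsNonzeroSquare : F → Set
IsNonzeroSquare a = (¬ a ≡ 0F) × (∃[ c ] c * c ≡ a)

record Aut : Set where
  constructor aut
  field
    a      : F
    b      : F
    v      : Fin 2
    a-nsq  : IsNonzeroSquare a

apply : Aut → F → F
apply (aut a b v _) γ = a * (γ ^ (17 ℕ.^ toℕ v)) + b

Subset : Set₁
Subset = F → Set

image : (F → F) → Subset → Subset
image g S y = ∃[ x ] (S x × g x ≡ y)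

_≐_ : Subset → Subset → Set
S ≐ T = ∀ x → S x ⇔ T x

Stabilizes : Aut → Subset → Set
Stabilizes g S = image (apply g) S ≐ S

OrbitSize : Subset → ℕ → Set
OrbitSize S N =
  Σ (Fin N → Aut) λ f →
    (∀ i j → image (apply (f i)) S ≐ image (apply (f j)) S → i ≡ j)
    × (∀ g → ∃[ i ] image (apply g) S ≐ image (apply (f i)) S)

Clist : F → List F
Clist α = 0F ∷ ι 1 ∷ ι 4 ∷ ι 16 ∷ ι 13
        ∷ (α + ι 7) * ι 1 ∷ (α + ι 7) * ι 16
        ∷ (α + ι 10) * ι 4 ∷ (α + ι 10) * ι 13 ∷ []

C : F → Subset
C α x = x ∈ Clist α

σ : F → F
σ γ = ι 4 * (γ ^ 17)

iter : (F → F) → ℕ → F → F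
iter g zero    x = x
iter g (suc n) x = g (iter g n x)

{-# OPTIONS --safe #-}

-- The Frobenius γ ↦ γ¹⁷ is the conjugation a + bα ↦ a − bα, so every automorphism of P(17²) is a
-- semilinear map γ ↦ a γ̄ᵛ + b, and σ = 4 · conj satisfies σᵏ = 4ᵏ conjᵏ, σ⁴ = 1, σ² = −1.
-- An automorphism stabilising C maps 0 and 1 into C, so b ∈ C and a + b ∈ C; this leaves
-- 9 · 9 · 2 candidate maps, and checking them shows that only the powers of σ stabilise C.
-- For the orbit, every automorphism factors as t ∘ σᵏ with t x = r x + b, where r runs over
-- representatives of the 72 classes of nonzero squares modulo ±1 and b over the field; if two
-- such t have the same image of C then t′⁻¹ ∘ t stabilises C and has no Galois part, so it is ±1.
-- The orbit therefore has 72 · 289 = 20808 elements.  The finitely many facts about individual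
-- field elements are checked by exhaustive computation over all 289 of them.

module Submission where

import Defs
open import Algebra.Bundles using (CommutativeRing)
open import Algebra.Core using (Op₁; Op₂)
import Algebra.Consequences.Propositional as Consequences
import Algebra.Properties.Group as GroupProperties
open import Algebra.Structures using (IsCommutativeRing)
open import Data.Bool using (if_then_else_; true; false)
import Data.Fin as Fin
open import Data.Fin using (Fin; toℕ; zero; suc)
import Data.Fin.Properties as Finₚ
open import Data.List using (List; allFin; cartesianProduct; filter; length; lookup)
open import Data.List.Membership.Propositional using (_∈_)
import Data.List.Membership.DecPropositional as DecMembership
open import Data.List.Membership.Propositional.Properties
  using (∈-allFin; ∈-cartesianProduct⁺; ∈-cartesianProduct⁻; ∈-filter⁺; ∈-filter⁻; ∈-lookup)
open import Data.List.Relation.Unary.All as All using (All)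
open import Data.List.Relation.Unary.AllPairs using (_∷_)
open import Data.List.Relation.Unary.Any using (here; there; index)
open import Data.List.Relation.Unary.Any.Properties using (lookup-index)
open import Data.List.Relation.Unary.Unique.Propositional using (Unique)
import Data.List.Relation.Unary.Unique.Propositional.Properties as Unique
open import Data.Nat as ℕ using (ℕ; NonZero; _%_; _∸_)
open import Data.Nat.DivMod using (_mod_; %-distribˡ-+; %-distribˡ-*; m%n%n≡m%n; m<n⇒m%n≡m; n%n≡0; m*n%n≡0)
import Data.Nat.Properties as ℕ
open import Data.Product using (_×_; _,_; ∃; ∃-syntax; proj₁; proj₂; map₂)
open import Data.Product.Properties using (≡-dec)
open import Data.Sum using (_⊎_; inj₁; inj₂; [_,_]′)
open import Function using (id)
open import Function.Bundles using (_⇔_; mk⇔; Equivalence)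
import Function.Properties.Equivalence as ⇔
open import Level using (0ℓ)
open import Relation.Binary using (DecidableEquality)
open import Relation.Binary.PropositionalEquality
  using (_≡_; refl; sym; trans; cong; cong₂; subst; isEquivalence; module ≡-Reasoning)
open import Relation.Nullary using (¬_; Dec; contradiction)
open import Relation.Nullary.Decidable
  using (toWitness; toWitnessFalse; map′; dec⇒maybe; ¬?; _×-dec_; _⊎-dec_; _→-dec_)
open import Relation.Unary using (Pred; Decidable; _⊆_)
open import Tactic.RingSolver using (solve-∀)
open import Tactic.RingSolver.Core.AlmostCommutativeRing using (AlmostCommutativeRing; fromCommutativeRing)

-- Commutative rings, ℤ/nℤ and quadratic extensions

module _ {a} {A : Set a} {_+_ _*_ : Op₂ A} { -_ : Op₁ A} {0# 1# : A} where
  open import Algebra.Definitions {A = A} _≡_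

  isCommutativeRingˡ : Associative _+_ → Commutative _+_ → LeftIdentity 0# _+_ → LeftInverse 0# -_ _+_ →
                       Associative _*_ → Commutative _*_ → LeftIdentity 1# _*_ → _*_ DistributesOverʳ _+_ →
                       IsCommutativeRing _≡_ _+_ _*_ -_ 0# 1#
  isCommutativeRingˡ +-assoc +-comm +-identityˡ -‿inverseˡ *-assoc *-comm *-identityˡ distribʳ = record
    { isRing = record
      { +-isAbelianGroup = record
        { isGroup = record
          { isMonoid = record
            { isSemigroup = record
              { isMagma = record { isEquivalence = isEquivalence ; ∙-cong = cong₂ _+_ }
              ; assoc = +-assoc }
            ; identity = Consequences.comm∧idˡ⇒id +-comm +-identityˡ }
          ; inverse = Consequences.comm∧invˡ⇒inv +-comm -‿inverseˡ
          ; ⁻¹-cong = cong -_ }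
        ; comm = +-comm }
      ; *-cong = cong₂ _*_
      ; *-assoc = *-assoc
      ; *-identity = Consequences.comm∧idˡ⇒id *-comm *-identityˡ
      ; distrib = Consequences.comm∧distrʳ⇒distrˡ *-comm distribʳ , distribʳ }
    ; *-comm = *-comm }

module ModularArithmetic (n : ℕ) .{{_ : NonZero n}} where
  open ≡-Reasoning

  infixl 6 _+ₙ_
  infixl 7 _*ₙ_

  _+ₙ_ _*ₙ_ : Op₂ (Fin n)
  x +ₙ y = (toℕ x ℕ.+ toℕ y) mod n
  x *ₙ y = (toℕ x ℕ.* toℕ y) mod n

  -ₙ_ : Op₁ (Fin n)
  -ₙ x = (n ∸ toℕ x) mod n

  mod-cong : ∀ {k m} → k % n ≡ m % n → k mod n ≡ m mod n
  mod-cong eq = Finₚ.toℕ-injective (trans (Finₚ.toℕ-fromℕ< _) (trans eq (sym (Finₚ.toℕ-fromℕ< _))))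

  toℕ-mod : ∀ x → toℕ x mod n ≡ x
  toℕ-mod x = Finₚ.toℕ-injective (trans (Finₚ.toℕ-fromℕ< _) (m<n⇒m%n≡m (Finₚ.toℕ<n x)))

  module _ (_∙_ : Op₂ ℕ) (%-distrib : ∀ k m → (k ∙ m) % n ≡ ((k % n) ∙ (m % n)) % n) where

    mod-absorbˡ : ∀ k m → (toℕ (k mod n) ∙ m) mod n ≡ (k ∙ m) mod n
    mod-absorbˡ k m = mod-cong (begin
      (toℕ (k mod n) ∙ m) % n        ≡⟨ cong (λ i → (i ∙ m) % n) (Finₚ.toℕ-fromℕ< _) ⟩
      ((k % n) ∙ m) % n              ≡⟨ %-distrib (k % n) m ⟩
      ((k % n % n) ∙ (m % n)) % n    ≡⟨ cong (λ i → (i ∙ (m % n)) % n) (m%n%n≡m%n k n) ⟩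
      ((k % n) ∙ (m % n)) % n        ≡⟨ %-distrib k m ⟨
      (k ∙ m) % n                    ∎)

    mod-absorbʳ : ∀ k m → (k ∙ toℕ (m mod n)) mod n ≡ (k ∙ m) mod n
    mod-absorbʳ k m = mod-cong (begin
      (k ∙ toℕ (m mod n)) % n        ≡⟨ cong (λ i → (k ∙ i) % n) (Finₚ.toℕ-fromℕ< _) ⟩
      (k ∙ (m % n)) % n              ≡⟨ %-distrib k (m % n) ⟩
      ((k % n) ∙ (m % n % n)) % n    ≡⟨ cong (λ i → ((k % n) ∙ i) % n) (m%n%n≡m%n m n) ⟩
      ((k % n) ∙ (m % n)) % n        ≡⟨ %-distrib k m ⟨
      (k ∙ m) % n                    ∎)

  mod-absorbˡ-+ : ∀ k m → (toℕ (k mod n) ℕ.+ m) mod n ≡ (k ℕ.+ m) mod n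
  mod-absorbˡ-+ = mod-absorbˡ ℕ._+_ (λ k m → %-distribˡ-+ k m n)

  mod-absorbʳ-+ : ∀ k m → (k ℕ.+ toℕ (m mod n)) mod n ≡ (k ℕ.+ m) mod n
  mod-absorbʳ-+ = mod-absorbʳ ℕ._+_ (λ k m → %-distribˡ-+ k m n)

  mod-absorbˡ-* : ∀ k m → (toℕ (k mod n) ℕ.* m) mod n ≡ (k ℕ.* m) mod n
  mod-absorbˡ-* = mod-absorbˡ ℕ._*_ (λ k m → %-distribˡ-* k m n)

  mod-absorbʳ-* : ∀ k m → (k ℕ.* toℕ (m mod n)) mod n ≡ (k ℕ.* m) mod n
  mod-absorbʳ-* = mod-absorbʳ ℕ._*_ (λ k m → %-distribˡ-* k m n)

  isCommutativeRing : IsCommutativeRing _≡_ _+ₙ_ _*ₙ_ -ₙ_ (0 mod n) (1 mod n)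
  isCommutativeRing =
    isCommutativeRingˡ +-assoc +-comm +-identityˡ -‿inverseˡ *-assoc *-comm *-identityˡ distribʳ
    where
    +-assoc : ∀ x y z → x +ₙ y +ₙ z ≡ x +ₙ (y +ₙ z)
    +-assoc x y z = begin
      x +ₙ y +ₙ z                             ≡⟨ mod-absorbˡ-+ (toℕ x ℕ.+ toℕ y) (toℕ z) ⟩
      (toℕ x ℕ.+ toℕ y ℕ.+ toℕ z) mod n       ≡⟨ cong (_mod n) (ℕ.+-assoc (toℕ x) _ _) ⟩
      (toℕ x ℕ.+ (toℕ y ℕ.+ toℕ z)) mod n     ≡⟨ mod-absorbʳ-+ (toℕ x) (toℕ y ℕ.+ toℕ z) ⟨
      x +ₙ (y +ₙ z)                           ∎

    *-assoc : ∀ x y z → x *ₙ y *ₙ z ≡ x *ₙ (y *ₙ z)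
    *-assoc x y z = begin
      x *ₙ y *ₙ z                             ≡⟨ mod-absorbˡ-* (toℕ x ℕ.* toℕ y) (toℕ z) ⟩
      (toℕ x ℕ.* toℕ y ℕ.* toℕ z) mod n       ≡⟨ cong (_mod n) (ℕ.*-assoc (toℕ x) _ _) ⟩
      (toℕ x ℕ.* (toℕ y ℕ.* toℕ z)) mod n     ≡⟨ mod-absorbʳ-* (toℕ x) (toℕ y ℕ.* toℕ z) ⟨
      x *ₙ (y *ₙ z)                           ∎

    +-comm : ∀ x y → x +ₙ y ≡ y +ₙ x
    +-comm x y = cong (_mod n) (ℕ.+-comm (toℕ x) (toℕ y))

    *-comm : ∀ x y → x *ₙ y ≡ y *ₙ x
    *-comm x y = cong (_mod n) (ℕ.*-comm (toℕ x) (toℕ y))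

    +-identityˡ : ∀ x → 0 mod n +ₙ x ≡ x
    +-identityˡ x = trans (mod-absorbˡ-+ 0 (toℕ x)) (toℕ-mod x)

    *-identityˡ : ∀ x → 1 mod n *ₙ x ≡ x
    *-identityˡ x = begin
      1 mod n *ₙ x          ≡⟨ mod-absorbˡ-* 1 (toℕ x) ⟩
      (1 ℕ.* toℕ x) mod n   ≡⟨ cong (_mod n) (ℕ.*-identityˡ (toℕ x)) ⟩
      toℕ x mod n           ≡⟨ toℕ-mod x ⟩
      x                     ∎

    -‿inverseˡ : ∀ x → (-ₙ x) +ₙ x ≡ 0 mod n
    -‿inverseˡ x = begin
      (-ₙ x) +ₙ x                   ≡⟨ mod-absorbˡ-+ (n ∸ toℕ x) (toℕ x) ⟩
      (n ∸ toℕ x ℕ.+ toℕ x) mod n   ≡⟨ cong (_mod n) (ℕ.m∸n+n≡m (ℕ.<⇒≤ (Finₚ.toℕ<n x))) ⟩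
      n mod n                       ≡⟨ mod-cong (trans (n%n≡0 n) (sym (m*n%n≡0 0 n))) ⟩
      0 mod n                       ∎

    distribʳ : ∀ x y z → (y +ₙ z) *ₙ x ≡ y *ₙ x +ₙ z *ₙ x
    distribʳ x y z = begin
      (y +ₙ z) *ₙ x                                 ≡⟨ mod-absorbˡ-* (toℕ y ℕ.+ toℕ z) (toℕ x) ⟩
      ((toℕ y ℕ.+ toℕ z) ℕ.* toℕ x) mod n           ≡⟨ cong (_mod n) (ℕ.*-distribʳ-+ (toℕ x) (toℕ y) _) ⟩
      (toℕ y ℕ.* toℕ x ℕ.+ toℕ z ℕ.* toℕ x) mod n   ≡⟨ mod-absorbʳ-+ (toℕ y ℕ.* toℕ x) _ ⟨
      (toℕ y ℕ.* toℕ x ℕ.+ toℕ (z *ₙ x)) mod n      ≡⟨ mod-absorbˡ-+ (toℕ y ℕ.* toℕ x) _ ⟨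
      y *ₙ x +ₙ z *ₙ x                              ∎

-- The ring A[√d]: the pair (a , b) stands for a + b √d.
module QuadraticExtension {a} {A : Set a} {plus times : Op₂ A} {negate : Op₁ A} {0ᴬ 1ᴬ : A}
  (isCommRing : IsCommutativeRing _≡_ plus times negate 0ᴬ 1ᴬ) (d : A) where

  private
    R : CommutativeRing a a
    R = record { isCommutativeRing = isCommRing }

  open CommutativeRing R
    using (_+_; _*_; -_; 0#; 1#; +-identityˡ; +-identityʳ; -‿inverseˡ; *-identityˡ; zeroˡ; zeroʳ)
    renaming (+-assoc to +ᴬ-assoc; +-comm to +ᴬ-comm)
  open import Algebra.Solver.Ring.NaturalCoefficients.Default (CommutativeRing.commutativeSemiring R)

  infixl 6 _⊕_
  infixl 7 _⊛_

  _⊕_ _⊛_ : Op₂ (A × A)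
  (a , b) ⊕ (c , e) = (a + c , b + e)
  (a , b) ⊛ (c , e) = (a * c + d * (b * e) , a * e + b * c)

  ⊖_ conj : Op₁ (A × A)
  ⊖ (a , b)    = (- a , - b)
  conj (a , b) = (a , - b)

  isCommutativeRing : IsCommutativeRing _≡_ _⊕_ _⊛_ ⊖_ (0# , 0#) (1# , 0#)
  isCommutativeRing =
    isCommutativeRingˡ ⊕-assoc ⊕-comm ⊕-identityˡ ⊖-inverseˡ ⊛-assoc ⊛-comm ⊛-identityˡ ⊛-distribʳ
    where
    ⊕-assoc : ∀ x y z → x ⊕ y ⊕ z ≡ x ⊕ (y ⊕ z)
    ⊕-assoc (a , b) (c , e) (f , g) = cong₂ _,_ (+ᴬ-assoc a c f) (+ᴬ-assoc b e g)

    ⊕-comm : ∀ x y → x ⊕ y ≡ y ⊕ x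
    ⊕-comm (a , b) (c , e) = cong₂ _,_ (+ᴬ-comm a c) (+ᴬ-comm b e)

    ⊕-identityˡ : ∀ x → (0# , 0#) ⊕ x ≡ x
    ⊕-identityˡ (a , b) = cong₂ _,_ (+-identityˡ a) (+-identityˡ b)

    ⊖-inverseˡ : ∀ x → ⊖ x ⊕ x ≡ (0# , 0#)
    ⊖-inverseˡ (a , b) = cong₂ _,_ (-‿inverseˡ a) (-‿inverseˡ b)

    ⊛-identityˡ : ∀ x → (1# , 0#) ⊛ x ≡ x
    ⊛-identityˡ (a , b) = cong₂ _,_
      (trans (cong₂ _+_ (*-identityˡ a) (trans (cong (d *_) (zeroˡ b)) (zeroʳ d))) (+-identityʳ a))
      (trans (cong₂ _+_ (*-identityˡ b) (zeroˡ a)) (+-identityʳ b))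

    ⊛-assoc : ∀ x y z → x ⊛ y ⊛ z ≡ x ⊛ (y ⊛ z)
    ⊛-assoc (a , b) (c , e) (f , g) = cong₂ _,_
      (solve 7 (λ a b c e f g d → (a :* c :+ d :* (b :* e)) :* f :+ d :* ((a :* e :+ b :* c) :* g)
                               := a :* (c :* f :+ d :* (e :* g)) :+ d :* (b :* (c :* g :+ e :* f))) refl a b c e f g d)
      (solve 7 (λ a b c e f g d → (a :* c :+ d :* (b :* e)) :* g :+ (a :* e :+ b :* c) :* f
                               := a :* (c :* g :+ e :* f) :+ b :* (c :* f :+ d :* (e :* g))) refl a b c e f g d)

    ⊛-comm : ∀ x y → x ⊛ y ≡ y ⊛ x
    ⊛-comm (a , b) (c , e) = cong₂ _,_
      (solve 5 (λ a b c e d → a :* c :+ d :* (b :* e) := c :* a :+ d :* (e :* b)) refl a b c e d)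
      (solve 4 (λ a b c e → a :* e :+ b :* c := c :* b :+ e :* a) refl a b c e)

    ⊛-distribʳ : ∀ x y z → (y ⊕ z) ⊛ x ≡ y ⊛ x ⊕ z ⊛ x
    ⊛-distribʳ (a , b) (c , e) (f , g) = cong₂ _,_
      (solve 7 (λ a b c e f g d → (c :+ f) :* a :+ d :* ((e :+ g) :* b)
                               := (c :* a :+ d :* (e :* b)) :+ (f :* a :+ d :* (g :* b))) refl a b c e f g d)
      (solve 6 (λ a b c e f g → (c :+ f) :* b :+ (e :+ g) :* a
                             := (c :* b :+ e :* a) :+ (f :* b :+ g :* a)) refl a b c e f g)

-- The field 𝔽₁₇²

open Defs

𝔽₁₇-isCommutativeRing : IsCommutativeRing _≡_ _+₁₇_ _*₁₇_ -₁₇_ [ 0 ]₁₇ [ 1 ]₁₇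
𝔽₁₇-isCommutativeRing = ModularArithmetic.isCommutativeRing 17

module 𝔽 = QuadraticExtension 𝔽₁₇-isCommutativeRing δ₁₇
open 𝔽 using (conj)

-- Definitionally 𝔽.⊖_, but the ring solver recognises the operations of F by their names.
-_ : F → F
- (a , b) = (-₁₇ a , -₁₇ b)

infixl 6 _-_
_-_ : F → F → F
x - y = x + - y

F-isCommutativeRing : IsCommutativeRing _≡_ _+_ _*_ -_ 0F 1F
F-isCommutativeRing = 𝔽.isCommutativeRing

F-commutativeRing : CommutativeRing 0ℓ 0ℓ
F-commutativeRing = record
  { _+_ = _+_ ; _*_ = _*_ ; -_ = -_ ; 0# = 0F ; 1# = 1F ; isCommutativeRing = F-isCommutativeRing }

open CommutativeRing F-commutativeRing
  using (+-identityˡ; +-identityʳ; *-identityˡ; *-identityʳ; zeroˡ; zeroʳ; *-assoc; *-comm; +-group)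
open GroupProperties +-group using (x∙y⁻¹≈ε⇒x≈y)

infix 4 _≟_
_≟_ : DecidableEquality F
_≟_ = ≡-dec Fin._≟_ Fin._≟_

open DecMembership _≟_ using (_∈?_)

-- The coefficients are concrete elements of F, so the solver needs a genuine zero test to drop vanishing ones.
F-almostCommutativeRing : AlmostCommutativeRing 0ℓ 0ℓ
F-almostCommutativeRing = fromCommutativeRing F-commutativeRing (λ x → dec⇒maybe (0F ≟ x))

x+y-y≡x : ∀ x y → x + y - y ≡ x
x+y-y≡x = solve-∀ F-almostCommutativeRing

module _ {p} {P : Pred F p} (P? : Decidable P) where

  all? : Dec (∀ x → P x)
  all? = map′ (λ h (a , b) → h a b) (λ h a b → h (a , b))
              (Finₚ.all? λ a → Finₚ.all? λ b → P? (a , b))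

  any? : Dec (∃ P)
  any? = map′ (λ (a , b , h) → (a , b) , h) (λ ((a , b) , h) → a , b , h)
              (Finₚ.any? λ a → Finₚ.any? λ b → P? (a , b))

elements : List F
elements = cartesianProduct (allFin 17) (allFin 17)

∈-elements : ∀ x → x ∈ elements
∈-elements (a , b) = ∈-cartesianProduct⁺ (∈-allFin a) (∈-allFin b)

elements-unique : Unique elements
elements-unique = Unique.cartesianProduct⁺ (Unique.allFin⁺ 17) (Unique.allFin⁺ 17)

-- Semilinear maps and σ

-- The decided facts are opaque so that later conversion checks never re-run the decision procedures.
opaque
  frobenius : ∀ γ → γ ^ 17 ≡ conj γ
  frobenius = toWitness {a? = all? λ γ → γ ^ 17 ≟ conj γ} _

galois : Fin 2 → F → F
galois zero    γ = γ
galois (suc zero) γ = conj γ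

galois-ι : ∀ v n → galois v (ι n) ≡ ι n
galois-ι zero       n = refl
galois-ι (suc zero) n = refl

semilinear : F → F → Fin 2 → F → F
semilinear a b v γ = a * galois v γ + b

semilinear-0 : ∀ a b v → semilinear a b v 0F ≡ b
semilinear-0 a b v = trans (cong (λ z → a * z + b) (galois-ι v 0)) (trans (cong (_+ b) (zeroʳ a)) (+-identityˡ b))

semilinear-1 : ∀ a b v → semilinear a b v 1F ≡ a + b
semilinear-1 a b v = trans (cong (λ z → a * z + b) (galois-ι v 1)) (cong (_+ b) (*-identityʳ a))

apply-semilinear : ∀ g γ → apply g γ ≡ semilinear (Aut.a g) (Aut.b g) (Aut.v g) γ
apply-semilinear (aut a b zero _)       γ = cong (λ z → a * z + b) (*-identityʳ γ)
apply-semilinear (aut a b (suc zero) _) γ = cong (λ z → a * z + b) (frobenius γ)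

infixr 4 _≐-trans_
_≐-trans_ : ∀ {S T U : Subset} → S ≐ T → T ≐ U → S ≐ U
(S≐T ≐-trans T≐U) x = ⇔.trans (S≐T x) (T≐U x)

module _ (S : Subset) where

  image-cong : ∀ {g h : F → F} → (∀ x → g x ≡ h x) → image g S ≐ image h S
  image-cong g≗h y = mk⇔ (λ (x , Sx , gx≡y) → x , Sx , trans (sym (g≗h x)) gx≡y)
                         (λ (x , Sx , hx≡y) → x , Sx , trans (g≗h x) hx≡y)

  image-∘ : ∀ (h : F → F) {s : F → F} → image s S ≐ S → image (λ x → h (s x)) S ≐ image h S
  image-∘ h {s} s-stable y = mk⇔ to from
    where
    to : image (λ x → h (s x)) S y → image h S y
    to (x , Sx , eq) = s x , Equivalence.to (s-stable (s x)) (x , Sx , refl) , eq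
    from : image h S y → image (λ x → h (s x)) S y
    from (z , Sz , eq) with Equivalence.from (s-stable z) Sz
    ... | x , Sx , sx≡z = x , Sx , trans (cong h sx≡z) eq

  module _ (h : F → F) (h-maps : image h S ⊆ S) where

    iter-maps : ∀ n {x} → S x → S (iter h n x)
    iter-maps ℕ.zero    Sx = Sx
    iter-maps (ℕ.suc n) Sx = h-maps (_ , iter-maps n Sx , refl)

    iter-stabilises : ∀ {n} → (∀ x → iter h n x ≡ x) → ∀ (k : Fin n) → image (iter h (toℕ k)) S ≐ S
    iter-stabilises {n} periodic k x = mk⇔
      (λ (y , Sy , eq) → subst S eq (iter-maps (toℕ k) Sy))
      (λ Sx → iter h (n ∸ toℕ k) x , iter-maps (n ∸ toℕ k) Sx , (begin
        iter h (toℕ k) (iter h (n ∸ toℕ k) x) ≡⟨ iter-+ (toℕ k) (n ∸ toℕ k) ⟨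
        iter h (toℕ k ℕ.+ (n ∸ toℕ k)) x      ≡⟨ cong (λ m → iter h m x) (ℕ.m+[n∸m]≡n k≤n) ⟩
        iter h n x                            ≡⟨ periodic x ⟩
        x                                     ∎))
      where
      open ≡-Reasoning
      k≤n : toℕ k ℕ.≤ n
      k≤n = ℕ.<⇒≤ (Finₚ.toℕ<n k)
      iter-+ : ∀ m n → iter h (m ℕ.+ n) x ≡ iter h m (iter h n x)
      iter-+ ℕ.zero    n = refl
      iter-+ (ℕ.suc m) n = cong h (iter-+ m n)

iter-cong : ∀ {f g : F → F} → (∀ x → f x ≡ g x) → ∀ n x → iter f n x ≡ iter g n x
iter-cong         f≗g ℕ.zero    x = refl
iter-cong {g = g} f≗g (ℕ.suc n) x = trans (f≗g _) (cong g (iter-cong f≗g n x))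

σ′ : F → F
σ′ γ = ι 4 * conj γ

σ-conj : ∀ γ → σ γ ≡ σ′ γ
σ-conj γ = cong (ι 4 *_) (frobenius γ)

iter-σ : ∀ n γ → iter σ n γ ≡ iter σ′ n γ
iter-σ = iter-cong σ-conj

opaque
  σ′-power : ∀ (k : Fin 4) γ → iter σ′ (toℕ k) γ ≡ semilinear (ι 4 ^ toℕ k) 0F (toℕ k mod 2) γ
  σ′-power = toWitness {a? = Finₚ.all? λ k → all? λ γ →
    iter σ′ (toℕ k) γ ≟ semilinear (ι 4 ^ toℕ k) 0F (toℕ k mod 2) γ} _

  σ′⁴≡id : ∀ γ → iter σ′ 4 γ ≡ γ
  σ′⁴≡id = toWitness {a? = all? λ γ → iter σ′ 4 γ ≟ γ} _

σ-power : ∀ (k : Fin 4) γ → iter σ (toℕ k) γ ≡ semilinear (ι 4 ^ toℕ k) 0F (toℕ k mod 2) γ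
σ-power k γ = trans (iter-σ (toℕ k) γ) (σ′-power k γ)

σ⁴≡id : ∀ γ → iter σ 4 γ ≡ γ
σ⁴≡id γ = trans (iter-σ 4 γ) (σ′⁴≡id γ)

σ²≢id : ¬ (∀ γ → iter σ 2 γ ≡ γ)
σ²≢id σ²≡id = toWitnessFalse {a? = iter σ′ 2 1F ≟ 1F} _ (trans (sym (iter-σ 2 1F)) (σ²≡id 1F))

σ∈Aut : ∃[ s ] (∀ γ → apply s γ ≡ σ γ)
σ∈Aut = aut (ι 4) 0F (suc zero) ((λ ()) , ι 2 , refl) , λ γ → +-identityʳ (σ γ)

-- The stabiliser of C

IsPowerOfσ : F → F → Fin 2 → Set
IsPowerOfσ a b v = ∃[ k ] (a ≡ ι 4 ^ toℕ {4} k × b ≡ 0F × v ≡ toℕ k mod 2)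

isPowerOfσ? : ∀ a b v → Dec (IsPowerOfσ a b v)
isPowerOfσ? a b v = Finₚ.any? λ k → (a ≟ ι 4 ^ toℕ k) ×-dec (b ≟ 0F) ×-dec (v Fin.≟ toℕ k mod 2)

powerOfσ-iter : ∀ {a b v} → IsPowerOfσ a b v →
                ∃[ k ] (∀ γ → semilinear a b v γ ≡ iter σ (toℕ {4} k) γ)
powerOfσ-iter (k , refl , refl , refl) = k , λ γ → sym (σ-power k γ)

powerOfσ-untwisted : ∀ {a b} → IsPowerOfσ a b zero → (a ≡ 1F ⊎ a ≡ ι 16) × b ≡ 0F
powerOfσ-untwisted (zero , a≡1 , b≡0 , _)            = inj₁ a≡1 , b≡0
powerOfσ-untwisted (suc (suc zero) , a≡-1 , b≡0 , _) = inj₂ a≡-1 , b≡0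
powerOfσ-untwisted (suc zero , _ , _ , ())
powerOfσ-untwisted (suc (suc (suc zero)) , _ , _ , ())

StabiliserCandidate : F → F → F → Fin 2 → Set
StabiliserCandidate α a b v =
  a ≡ 0F ⊎ ¬ All (λ x → semilinear a b v x ∈ Clist α) (Clist α) ⊎ IsPowerOfσ a b v

stabiliserCandidate? : ∀ α a b v → Dec (StabiliserCandidate α a b v)
stabiliserCandidate? α a b v =
  (a ≟ 0F) ⊎-dec ¬? (All.all? (λ x → semilinear a b v x ∈? Clist α) (Clist α)) ⊎-dec isPowerOfσ? a b v

opaque
  σ′-preserves-Clist : ∀ α → α * α ≡ δ → All (λ x → σ′ x ∈ Clist α) (Clist α)
  σ′-preserves-Clist = toWitness {a? = all? λ α → (α * α ≟ δ) →-dec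
    All.all? (λ x → σ′ x ∈? Clist α) (Clist α)} _

  stabiliser-candidates : ∀ α → α * α ≡ δ →
    All (λ b → All (λ c → ∀ v → StabiliserCandidate α (c - b) b v) (Clist α)) (Clist α)
  stabiliser-candidates = toWitness {a? = all? λ α → (α * α ≟ δ) →-dec
    All.all? (λ b → All.all? (λ c → Finₚ.all? λ v →
      stabiliserCandidate? α (c - b) b v) (Clist α)) (Clist α)} _

module _ (α : F) (α²≡δ : α * α ≡ δ) where

  σ-preserves-C : image σ (C α) ⊆ C α
  σ-preserves-C (x , x∈C , refl) =
    subst (_∈ Clist α) (sym (σ-conj x)) (All.lookup (σ′-preserves-Clist α α²≡δ) x∈C)

  σ-power-stabilises-C : ∀ (k : Fin 4) → image (iter σ (toℕ k)) (C α) ≐ C α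
  σ-power-stabilises-C = iter-stabilises (C α) σ σ-preserves-C σ⁴≡id

  preserves-C⇒isPowerOfσ : ∀ {a b v} → ¬ a ≡ 0F → image (semilinear a b v) (C α) ⊆ C α →
                           IsPowerOfσ a b v
  preserves-C⇒isPowerOfσ {a} {b} {v} a≢0 maps =
    resolve (subst (λ a → StabiliserCandidate α a b v) (x+y-y≡x a b) candidate)
    where
    b∈C : b ∈ Clist α
    b∈C = subst (_∈ Clist α) (semilinear-0 a b v) (maps (0F , here refl , refl))
    a+b∈C : a + b ∈ Clist α
    a+b∈C = subst (_∈ Clist α) (semilinear-1 a b v) (maps (1F , there (here refl) , refl))
    candidate : StabiliserCandidate α (a + b - b) b v
    candidate = All.lookup (All.lookup (stabiliser-candidates α α²≡δ) b∈C) a+b∈C v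
    resolve : StabiliserCandidate α a b v → IsPowerOfσ a b v
    resolve (inj₁ a≡0)          = contradiction a≡0 a≢0
    resolve (inj₂ (inj₁ ¬maps)) = contradiction (All.tabulate λ x∈C → maps (_ , x∈C , refl)) ¬maps
    resolve (inj₂ (inj₂ power)) = power

  stabiliser-C : ∀ g → Stabilizes g (C α) ⇔ (∃[ k ] (∀ γ → apply g γ ≡ iter σ (toℕ {4} k) γ))
  stabiliser-C g@(aut a b v (a≢0 , _)) = mk⇔ to from
    where
    to : Stabilizes g (C α) → ∃[ k ] (∀ γ → apply g γ ≡ iter σ (toℕ {4} k) γ)
    to stab = map₂ (λ eq γ → trans (apply-semilinear g γ) (eq γ))
                   (powerOfσ-iter (preserves-C⇒isPowerOfσ {a} {b} {v} a≢0 maps))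
      where
      maps : image (semilinear a b v) (C α) ⊆ C α
      maps p = Equivalence.to (stab _) (Equivalence.from (image-cong (C α) (apply-semilinear g) _) p)
    from : ∃[ k ] (∀ γ → apply g γ ≡ iter σ (toℕ {4} k) γ) → Stabilizes g (C α)
    from (k , eq) = image-cong (C α) eq ≐-trans σ-power-stabilises-C k

-- The orbit of C

opaque
  invertible : ∀ x → x ≡ 0F ⊎ ∃[ y ] y * x ≡ 1F
  invertible = toWitness {a? = all? λ x → (x ≟ 0F) ⊎-dec any? λ y → y * x ≟ 1F} _

inverse : ∀ {x} → ¬ x ≡ 0F → ∃[ y ] y * x ≡ 1F
inverse {x} x≢0 = [ (λ x≡0 → contradiction x≡0 x≢0) , id ]′ (invertible x)

module Cancel {r s : F} (s*r≡1 : s * r ≡ 1F) where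
  open ≡-Reasoning

  cancelˡ : ∀ x → s * (r * x) ≡ x
  cancelˡ x = begin
    s * (r * x)   ≡⟨ *-assoc s r x ⟨
    s * r * x     ≡⟨ cong (_* x) s*r≡1 ⟩
    1F * x        ≡⟨ *-identityˡ x ⟩
    x             ∎

  cancelʳ : ∀ x → r * (s * x) ≡ x
  cancelʳ x = begin
    r * (s * x)   ≡⟨ cong (r *_) (*-comm s x) ⟩
    r * (x * s)   ≡⟨ *-assoc r x s ⟨
    r * x * s     ≡⟨ *-comm (r * x) s ⟩
    s * (r * x)   ≡⟨ cancelˡ x ⟩
    x             ∎

  solve-affine : ∀ {a b c x y} → r * y + c ≡ a * x + b → y ≡ s * a * x + s * (b - c)
  solve-affine {a} {b} {c} {x} {y} eq = begin
    y                       ≡⟨ cancelˡ y ⟨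
    s * (r * y)             ≡⟨ cong (s *_) (x+y-y≡x (r * y) c) ⟨
    s * (r * y + c - c)     ≡⟨ cong (λ z → s * (z - c)) eq ⟩
    s * (a * x + b - c)     ≡⟨ distrib s a x b c ⟩
    s * a * x + s * (b - c) ∎
    where
    distrib : ∀ s a x b c → s * (a * x + b - c) ≡ s * a * x + s * (b - c)
    distrib = solve-∀ F-almostCommutativeRing

  relative-preserves : ∀ {S a b c} → image (semilinear a b zero) S ≐ image (semilinear r c zero) S →
                       image (semilinear (s * a) (s * (b - c)) zero) S ⊆ S
  relative-preserves {S} {a} {b} {c} same (x , Sx , refl) = preimage (Equivalence.to (same _) (x , Sx , refl))
    where
    preimage : image (semilinear r c zero) S (semilinear a b zero x) → S (semilinear (s * a) (s * (b - c)) zero x)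
    preimage (y , Sy , ry+c≡ax+b) = subst S (solve-affine ry+c≡ax+b) Sy

*-nonzero : ∀ {x y} → ¬ x ≡ 0F → ¬ y ≡ 0F → ¬ x * y ≡ 0F
*-nonzero {x} {y} x≢0 y≢0 xy≡0 = x≢0 (begin
  x              ≡⟨ cancelˡ x ⟨
  z * (y * x)    ≡⟨ cong (z *_) (*-comm y x) ⟩
  z * (x * y)    ≡⟨ cong (z *_) xy≡0 ⟩
  z * 0F         ≡⟨ zeroʳ z ⟩
  0F             ∎)
  where
  open ≡-Reasoning
  z : F
  z = proj₁ (inverse y≢0)
  open Cancel {y} {z} (proj₂ (inverse y≢0))

nonzeroSquare-* : ∀ {x y} → IsNonzeroSquare x → IsNonzeroSquare y → IsNonzeroSquare (x * y)
nonzeroSquare-* (x≢0 , c , cc≡x) (y≢0 , d , dd≡y) =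
  *-nonzero x≢0 y≢0 , c * d , trans (square-* c d) (cong₂ _*_ cc≡x dd≡y)
  where
  square-* : ∀ c d → (c * d) * (c * d) ≡ (c * c) * (d * d)
  square-* = solve-∀ F-almostCommutativeRing

code : F → ℕ
code (a , b) = toℕ a ℕ.* 17 ℕ.+ toℕ b

-- Since ι 16 = −1, canon x is whichever of x and −x has the smaller code.
canon : F → F
canon x = if code x ℕ.≤ᵇ code (x * ι 16) then x else x * ι 16

canon-cases : ∀ x → canon x ≡ x ⊎ canon x ≡ x * ι 16
canon-cases x with code x ℕ.≤ᵇ code (x * ι 16)
... | true  = inj₁ refl
... | false = inj₂ refl

opaque
  canon-*-ι16 : ∀ x → canon (x * ι 16) ≡ canon x
  canon-*-ι16 = toWitness {a? = all? λ x → canon (x * ι 16) ≟ canon x} _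

canon-idempotent : ∀ x → canon (canon x) ≡ canon x
canon-idempotent x = [ cong canon , (λ eq → trans (cong canon eq) (canon-*-ι16 x)) ]′ (canon-cases x)

canon-nonzeroSquare : ∀ {x} → IsNonzeroSquare x → IsNonzeroSquare (canon x)
canon-nonzeroSquare {x} x-sq = [ (λ eq → subst IsNonzeroSquare (sym eq) x-sq)
                               , (λ eq → subst IsNonzeroSquare (sym eq) (nonzeroSquare-* x-sq -1-sq)) ]′
                               (canon-cases x)
  where
  -1-sq : IsNonzeroSquare (ι 16)
  -1-sq = (λ ()) , ι 4 , refl

canonical-unique : ∀ {r r′} → canon r ≡ r → canon r′ ≡ r′ → r ≡ r′ * ι 16 → r ≡ r′
canonical-unique {r} {r′} r-canon r′-canon r≡-r′ = begin
  r                  ≡⟨ r-canon ⟨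
  canon r            ≡⟨ cong canon r≡-r′ ⟩
  canon (r′ * ι 16)  ≡⟨ canon-*-ι16 r′ ⟩
  canon r′           ≡⟨ r′-canon ⟩
  r′                 ∎
  where open ≡-Reasoning

IsClassRep : F → Set
IsClassRep r = canon r ≡ r × IsNonzeroSquare r

isClassRep? : ∀ r → Dec (IsClassRep r)
isClassRep? r = (canon r ≟ r) ×-dec ¬? (r ≟ 0F) ×-dec any? (λ c → c * c ≟ r)

ι13^-nonzeroSquare : ∀ v → IsNonzeroSquare (ι 13 ^ toℕ {2} v)
ι13^-nonzeroSquare zero       = (λ ()) , 1F , refl
ι13^-nonzeroSquare (suc zero) = (λ ()) , ι 8 , refl

-- As ι 13 = 4⁻¹, the representative is r = ±a · 4⁻ᵛ, and then a = r · 4ᵏ for k = v or k = v + 2.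
opaque
  multiplier-decomposition : ∀ a v →
    ∃[ k ] (v ≡ toℕ {4} k mod 2 × a ≡ canon (a * ι 13 ^ toℕ v) * ι 4 ^ toℕ k)
  multiplier-decomposition = toWitness {a? = all? λ a → Finₚ.all? λ v → Finₚ.any? λ k →
    (v Fin.≟ toℕ k mod 2) ×-dec (a ≟ canon (a * ι 13 ^ toℕ v) * ι 4 ^ toℕ k)} _

lookup-injective : ∀ {a} {A : Set a} {xs : List A} → Unique xs →
                   ∀ i j → lookup xs i ≡ lookup xs j → i ≡ j
lookup-injective (_   ∷ _) zero    zero    _  = refl
lookup-injective (x∉ ∷ _) zero    (suc j) eq = contradiction eq (All.lookup x∉ (∈-lookup j))
lookup-injective (x∉ ∷ _) (suc i) zero    eq = contradiction (sym eq) (All.lookup x∉ (∈-lookup i))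
lookup-injective (_   ∷ u) (suc i) (suc j) eq = cong suc (lookup-injective u i j eq)

-- Parametrised by an enumeration of F, so that the list below is only computed
-- where its length is needed.
module Transversal (xs : List F) (∈-xs : ∀ x → x ∈ xs) (xs-unique : Unique xs) where

  transversal : List (F × F)
  transversal = cartesianProduct (filter isClassRep? xs) xs

  transversal-unique : Unique transversal
  transversal-unique = Unique.cartesianProduct⁺ (Unique.filter⁺ isClassRep? xs-unique) xs-unique

  ∈-transversal⁺ : ∀ {r} b → IsClassRep r → (r , b) ∈ transversal
  ∈-transversal⁺ {r} b r-rep = ∈-cartesianProduct⁺ (∈-filter⁺ isClassRep? (∈-xs r) r-rep) (∈-xs b)

  ∈-transversal⁻ : ∀ {r b} → (r , b) ∈ transversal → IsClassRep r
  ∈-transversal⁻ t∈ =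
    proj₂ (∈-filter⁻ isClassRep? {xs = xs} (proj₁ (∈-cartesianProduct⁻ (filter isClassRep? xs) xs t∈)))

  shiftAut : ∀ {t} → t ∈ transversal → Aut
  shiftAut {r , b} t∈ = aut r b zero (proj₂ (∈-transversal⁻ t∈))

  representative : Fin (length transversal) → Aut
  representative i = shiftAut (∈-lookup {xs = transversal} i)

  apply-representative : ∀ i γ →
    apply (representative i) γ ≡ semilinear (proj₁ (lookup transversal i)) (proj₂ (lookup transversal i)) zero γ
  apply-representative i = apply-semilinear (representative i)

  module _ (α : F) (α²≡δ : α * α ≡ δ) where

    HasShiftImage : Aut → Set
    HasShiftImage g =
      ∃[ t ] (t ∈ transversal × image (apply g) (C α) ≐ image (semilinear (proj₁ t) (proj₂ t) zero) (C α))

    transversal-covers : ∀ g → HasShiftImage g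
    transversal-covers g@(aut a b v a-sq) = factor (multiplier-decomposition a v)
      where
      r : F
      r = canon (a * ι 13 ^ toℕ v)
      r-rep : IsClassRep r
      r-rep = canon-idempotent _ , canon-nonzeroSquare (nonzeroSquare-* a-sq (ι13^-nonzeroSquare v))
      factor : ∃[ k ] (v ≡ toℕ {4} k mod 2 × a ≡ r * ι 4 ^ toℕ k) → HasShiftImage g
      factor (k , v≡k , a≡rk) = (r , b) , ∈-transversal⁺ b r-rep ,
        (image-cong (C α) g≗rσᵏ ≐-trans
         image-∘ (C α) (semilinear r b zero) (σ-power-stabilises-C α α²≡δ k))
        where
        open ≡-Reasoning
        g≗rσᵏ : ∀ γ → apply g γ ≡ semilinear r b zero (iter σ (toℕ k) γ)
        g≗rσᵏ γ = begin
          apply g γ                                            ≡⟨ apply-semilinear g γ ⟩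
          a * galois v γ + b                                   ≡⟨ cong₂ (λ a v → a * galois v γ + b) a≡rk v≡k ⟩
          r * ι 4 ^ toℕ k * galois (toℕ k mod 2) γ + b         ≡⟨ cong (_+ b) (*-assoc r _ _) ⟩
          r * (ι 4 ^ toℕ k * galois (toℕ k mod 2) γ) + b       ≡⟨ cong (λ z → r * z + b) (+-identityʳ _) ⟨
          r * semilinear (ι 4 ^ toℕ k) 0F (toℕ k mod 2) γ + b  ≡⟨ cong (λ z → r * z + b) (σ-power k γ) ⟨
          r * iter σ (toℕ k) γ + b                             ∎

    shifts-distinct : ∀ {r b r′ b′} → IsClassRep r → IsClassRep r′ →
      image (semilinear r b zero) (C α) ≐ image (semilinear r′ b′ zero) (C α) → (r , b) ≡ (r′ , b′)
    shifts-distinct {r} {b} {r′} {b′} (r-canon , r≢0 , _) (r′-canon , r′≢0 , _) same =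
      cong₂ _,_ (r≡r′ (proj₁ u≡±1×w≡0)) (b≡b′ (proj₂ u≡±1×w≡0))
      where
      open ≡-Reasoning
      s : F
      s = proj₁ (inverse r′≢0)
      open Cancel {r′} {s} (proj₂ (inverse r′≢0))

      s*r≢0 : ¬ s * r ≡ 0F
      s*r≢0 u≡0 = r≢0 (begin
        r              ≡⟨ cancelʳ r ⟨
        r′ * (s * r)   ≡⟨ cong (r′ *_) u≡0 ⟩
        r′ * 0F        ≡⟨ zeroʳ r′ ⟩
        0F             ∎)

      u≡±1×w≡0 : (s * r ≡ 1F ⊎ s * r ≡ ι 16) × s * (b - b′) ≡ 0F
      u≡±1×w≡0 = powerOfσ-untwisted
        (preserves-C⇒isPowerOfσ α α²≡δ s*r≢0 (relative-preserves {C α} {r} {b} {b′} same))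

      r≡r′ : s * r ≡ 1F ⊎ s * r ≡ ι 16 → r ≡ r′
      r≡r′ (inj₁ u≡1)  = trans (sym (cancelʳ r)) (trans (cong (r′ *_) u≡1) (*-identityʳ r′))
      r≡r′ (inj₂ u≡-1) = canonical-unique r-canon r′-canon (trans (sym (cancelʳ r)) (cong (r′ *_) u≡-1))

      b≡b′ : s * (b - b′) ≡ 0F → b ≡ b′
      b≡b′ w≡0 = x∙y⁻¹≈ε⇒x≈y b b′ (begin
        b - b′               ≡⟨ cancelʳ (b - b′) ⟨
        r′ * (s * (b - b′))  ≡⟨ cong (r′ *_) w≡0 ⟩
        r′ * 0F              ≡⟨ zeroʳ r′ ⟩
        0F                   ∎)

    orbit-size : OrbitSize (C α) (length transversal)
    orbit-size = representative , distinct , covers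
      where
      distinct : ∀ i j → image (apply (representative i)) (C α) ≐ image (apply (representative j)) (C α) →
                 i ≡ j
      distinct i j same = lookup-injective transversal-unique i j
        (shifts-distinct (∈-transversal⁻ (∈-lookup {xs = transversal} i))
                         (∈-transversal⁻ (∈-lookup {xs = transversal} j))
                         (image-cong (C α) (λ γ → sym (apply-representative i γ))
                          ≐-trans same ≐-trans image-cong (C α) (apply-representative j)))
      covers : ∀ g → ∃[ i ] (image (apply g) (C α) ≐ image (apply (representative i)) (C α))
      covers g = reindex (transversal-covers g)
        where
        reindex : HasShiftImage g → ∃[ i ] (image (apply g) (C α) ≐ image (apply (representative i)) (C α))
        reindex (t , t∈ , g≐t) = index t∈ , (g≐t ≐-trans image-cong (C α) λ γ →
          trans (cong (λ t → semilinear (proj₁ t) (proj₂ t) zero γ) (lookup-index t∈))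
                (sym (apply-representative (index t∈) γ)))

length-transversal : length (Transversal.transversal elements ∈-elements elements-unique) ≡ 20808
length-transversal = refl

lemma3p13 : (α : F) → α * α ≡ δ →
    ((∃[ s ] (∀ γ → apply s γ ≡ σ γ))
    × (∀ g → Stabilizes g (C α) ⇔ (∃[ k ] (∀ γ → apply g γ ≡ iter σ (toℕ {4} k) γ)))
    × (∀ γ → iter σ 4 γ ≡ γ)
    × ¬ (∀ γ → iter σ 2 γ ≡ γ))
    × OrbitSize (C α) 20808
lemma3p13 α α²≡δ =
  (σ∈Aut , stabiliser-C α α²≡δ , σ⁴≡id , σ²≢id) ,
  subst (OrbitSize (C α)) length-transversal
    (Transversal.orbit-size elements ∈-elements elements-unique α α²≡δ)
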